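{- Let $d\ge 1$ and let $A_\bullet$ be the simplicial complex (the standard apartment) defined as follows. Put $A_0=\mathbb{Z}^{\oplus d}/\mathbb{Z}(1,\ldots,1)$. For $x,y\in\mathbb{Z}^{\oplus d}$ write $x\le y$ if $x_j\le y_j$ for all $j$. A finite subset $\tilde\sigma\subset\mathbb{Z}^{\oplus d}$ is called small if it can be written $\{x_0,\ldots,x_i\}$ with $x_0\lneq x_1\lneq\cdots\lneq x_i\lneq x_0+(1,\ldots,1)$. For $i\ge 0$, $A_i$ is the set of subsets $\sigma\subset A_0$ of cardinality $i+1$ which are the bijective image of a small subset of $\mathbb{Z}^{\oplus d}$; faces are subsets. For $\sigma\in A_{d-1}$, choose a small lift $\{x_1,\ldots,x_d\}$ with $x_0:=x_d-(1,\ldots,1)\lneq x_1\lneq\cdots\lneq x_d$; then $x_i-x_{i-1}=e_{w(i)}$ (a standard basis vector) for a permutation $w\in S_d$, and let $[\sigma]$ be the orientation of $\sigma$ given by the ordering $i\mapsto(\text{class of }x_{w^{ -1}(i)})$, $i=1,\dots,d$ (this does not depend on the lift). Let $\beta$ be the Borel–Moore $(d-1)$-chain with integer coefficients which has coefficient $1$ on $[\sigma]$ for every $\sigma\in A_{d-1}$. Then $\beta$ is a $(d-1)$-cycle in the chain complex computing the Borel–Moore homology $H^{\mathrm{BM}}_*(A_\bullet,\mathbb{Z})$.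
   Context: Homology conventions: for a locally finite simplicial complex $Y_\bullet$ and an $i$-simplex $\sigma$ with vertex set $V(\sigma)$ ($i+1$ elements), an orientation of $\sigma$ is an ordering $(u_1,\ldots,u_{i+1})$ of $V(\sigma)$ up to even permutations; the two orientations of $\sigma$ are identified with $\pm$ each other. The Borel–Moore chain group in degree $i$ with coefficients in $M$ is $\big(\prod_{\nu}M\big)_{\{\pm1\}}$, the product over all oriented $i$-simplices $\nu$, modulo the identification of the coefficient on $-\nu$ with minus the coefficient on $\nu$ (i.e. arbitrary, possibly infinite, formal sums of oriented simplices). The boundary sends an oriented simplex $(u_1,\ldots,u_{i+1})$ to $\sum_{k=1}^{i+1}(-1)^k(u_1,\ldots,\widehat{u_k},\ldots,u_{i+1})$ (the overall sign convention is irrelevant for being a cycle), extended to infinite sums, which is well defined by local finiteness. -}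

module Defs where

open import Data.Nat using (ℕ; zero; suc)
open import Data.Integer using (ℤ; +_; _+_; _-_; -_; _≤_)
open import Data.Fin using (Fin; zero; suc; inject₁; fromℕ; _≟_)
open import Data.Fin.Permutation using (Permutation′; _⟨$⟩ʳ_; transpose)
open import Data.Vec.Functional using (_∷_)
open import Data.List using (List; map; foldr)
open import Data.List.Membership.Propositional using (_∈_)
open import Data.List.Relation.Unary.AllPairs using (AllPairs)
open import Data.Product using (Σ; ∃; ∃-syntax; _×_)
open import Data.Unit using (⊤)
open import Data.Bool using (if_then_else_)
open import Relation.Nullary using (¬_; does)
open import Relation.Binary.PropositionalEquality using (_≡_)
open import Function using (_∘_)

Pt : ℕ → Set
Pt d = Fin d → ℤ

𝟙 : ∀ {d} → Pt d
𝟙 _ = + 1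

_+ᵖ_ : ∀ {d} → Pt d → Pt d → Pt d
(x +ᵖ y) j = x j + y j

_-ᵖ_ : ∀ {d} → Pt d → Pt d → Pt d
(x -ᵖ y) j = x j - y j

e : ∀ {d} → Fin d → Pt d
e j k = if does (j ≟ k) then + 1 else + 0

_≐_ : ∀ {d} → Pt d → Pt d → Set
x ≐ y = ∀ j → x j ≡ y j

_≤ᵖ_ : ∀ {d} → Pt d → Pt d → Set
x ≤ᵖ y = ∀ j → x j ≤ y j

_⪇_ : ∀ {d} → Pt d → Pt d → Set
x ⪇ y = (x ≤ᵖ y) × ¬ (x ≐ y)

-- Vertices: A₀ = ℤ^{⊕d} / ℤ(1,…,1), represented by points modulo ≈

_≈_ : ∀ {d} → Pt d → Pt d → Set
x ≈ y = ∃[ k ] (∀ j → x j ≡ y j + k)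

IsSmallChain : ∀ {d} (i : ℕ) → (Fin (suc i) → Pt d) → Set
IsSmallChain i z =
  (∀ (k : Fin i) → z (inject₁ k) ⪇ z (suc k)) × (z (fromℕ i) ⪇ (z zero +ᵖ 𝟙))

-- An ordering u = (u₀,…,uᵢ) of vertices (given by representatives) is an
-- ordering of the vertex set of an i-simplex of A_•: its set of classes is
-- the (bijective) image of a small subset {z₀,…,zᵢ} of ℤ^{⊕d}.
IsSimplex : ∀ {d} (i : ℕ) → (Fin (suc i) → Pt d) → Set
IsSimplex {d} i u =
  Σ (Fin (suc i) → Pt d) λ z → Σ (Permutation′ (suc i)) λ π →
    IsSmallChain i z × (∀ k → u k ≈ z (π ⟨$⟩ʳ k))

-- Borel–Moore i-chains with ℤ coefficients: functions on orderings of
-- i-simplices that depend only on the vertex classes and change sign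
-- under swapping two vertices (i.e. c(−ν) = −c(ν), orientation = ordering
-- up to even permutations).  Values on non-simplices are never used.

IsChain : (d i : ℕ) → ((Fin (suc i) → Pt d) → ℤ) → Set
IsChain d i c =
  (∀ u u′ → IsSimplex i u → (∀ k → u k ≈ u′ k) → c u ≡ c u′) ×
  (∀ u → IsSimplex i u → ∀ a b → ¬ (a ≡ b) →
     c (u ∘ (transpose a b ⟨$⟩ʳ_)) ≡ - c u)

-- For an ordering v of an i-simplex τ, a coface enumeration is a finite
-- list L of vertices w, pairwise in distinct classes, such that the
-- (i+1)-simplices containing τ are exactly the τ ∪ {w} with w ∈ L (up to ≈).

IsCofaceEnum : ∀ {d} (i : ℕ) → (Fin (suc i) → Pt d) → List (Pt d) → Set
IsCofaceEnum i v L =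
  (∀ {w} → w ∈ L → IsSimplex (suc i) (w ∷ v)) ×
  (∀ w → IsSimplex (suc i) (w ∷ v) → ∃[ w′ ] (w′ ∈ L × w ≈ w′)) ×
  AllPairs (λ a b → ¬ (a ≈ b)) L

sumℤ : List ℤ → ℤ
sumℤ = foldr _+_ (+ 0)

-- coefficient of ∂c on the oriented i-simplex v: each coface σ = τ ∪ {w},
-- oriented as (w, v₀, …, vᵢ), contributes (−1)¹ · c(w, v₀, …, vᵢ).
boundaryCoeff : ∀ {d i} → ((Fin (suc (suc i)) → Pt d) → ℤ) →
                (Fin (suc i) → Pt d) → List (Pt d) → ℤ
boundaryCoeff c v L = - sumℤ (map (λ w → c (w ∷ v)) L)

-- c is a cycle: degree-0 chains are always cycles; in degree i+1, for every
-- oriented i-simplex v, the coefficient of ∂c on v is well defined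
-- (a coface enumeration exists, local finiteness) and equals 0 (for any
-- coface enumeration).
IsCycle : (d i : ℕ) → ((Fin (suc i) → Pt d) → ℤ) → Set
IsCycle d zero c = ⊤
IsCycle d (suc i) c =
  ∀ (v : Fin (suc i) → Pt d) → IsSimplex i v →
    (∃[ L ] IsCofaceEnum i v L) ×
    (∀ L → IsCofaceEnum i v L → boundaryCoeff c v L ≡ + 0)

-- The orientation [σ] of a (d−1)-simplex, d = n+1.
-- A small lift x₁,…,x_d is indexed here by Fin (suc n) (x k ↔ x_{k+1}),
-- with predecessor prev x k (prev of x₁ is x₀ := x_d − (1,…,1)).

prev : ∀ {n} → (Fin (suc n) → Pt (suc n)) → Fin (suc n) → Pt (suc n)
prev {n} x zero    = x (fromℕ n) -ᵖ 𝟙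
prev     x (suc k) = x (inject₁ k)

-- u is the ordering [σ]: for some lift x₀ := x_d − 1 ⪇ x₁ ⪇ … ⪇ x_d,
-- position j holds the class of x_{w⁻¹(j)}, where x_k − x_{k−1} = e_{w(k)}.
IsStdOrientation : (n : ℕ) → (Fin (suc n) → Pt (suc n)) → Set
IsStdOrientation n u =
  ∃[ x ] ((∀ k → prev x k ⪇ x k) ×
          (∀ j → ∃[ k ] ((x k -ᵖ prev x k) ≐ e j × u j ≈ x k)))

-- A small chain z₀ ⪇ z₁ ⪇ ⋯ ⪇ zᵢ ⪇ z₀ + 𝟙 is a staircase: with b = zᵢ − 𝟙 there is a level
-- function τ from the d coordinates onto {0, …, i} such that z_k = b + Σ_{τ j ≤ k} e_j.
-- For a (d−2)-simplex τ maps d coordinates onto d − 1 levels, so exactly one level g is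
-- taken twice, by coordinates a ≠ a′.  A vertex w completing it to a (d−1)-simplex is
-- adjacent to, and distinct from, all of its vertices; comparability with the chain forces
-- w = b + Σ_{τ j < g} e_j + e_c with c ∈ {a, a′}.  Hence the boundary coefficient is
-- β(σ_a) + β(σ_a′).  Compared with the ordering (w, v₀, …) through one and the same
-- permutation ρ, the standard orientations of σ_a and σ_a′ differ by the transposition
-- (a a′), so the two coefficients are sign ρ and −sign ρ.

module Submission where

open import Defs
open import Data.Nat using (ℕ; suc)
open import Data.Integer using (ℤ; +_)
open import Data.Fin using (Fin)
open import Relation.Binary.PropositionalEquality using (_≡_)

open import Data.Bool using (Bool; true; false; not; if_then_else_)
import Data.Bool.Properties as 𝔹
open import Data.Empty using (⊥; ⊥-elim)
open import Data.Unit using (tt)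
open import Data.Sum as Sum using (_⊎_; inj₁; inj₂; [_,_])
open import Data.Fin as F using (zero; suc; toℕ; fromℕ; fromℕ<; inject₁; punchIn; punchOut)
import Data.Fin.Induction as FI
import Data.Fin.Properties as FP
open import Data.Integer as ℤ using (_+_; _-_; -_; _*_; -[1+_]; +≤+)
import Data.Integer.Properties as ℤP
open import Algebra.Properties.AbelianGroup ℤP.+-0-abelianGroup
  using () renaming (∙-cancelˡ to +-cancelˡ)
open import Data.Integer.Tactic.RingSolver using (solve-∀)
open import Data.Nat as ℕ using (zero; z≤n; s≤s; _≤?_; _<?_)
import Data.Nat.Properties as ℕP
open import Data.Product using (∃; ∃-syntax; ∃₂; _×_; _,_; proj₁; proj₂)
open import Data.Fin.Permutation
  using (Permutation′; permutation; _⟨$⟩ʳ_; _⟨$⟩ˡ_; _∘ₚ_; flip; insert; insert-punchIn;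
         inverseʳ; inverseˡ; transpose)
open import Data.Fin.Permutation.Transposition.List
  using (TranspositionList; eval; decompose; eval-decompose)
open import Data.List using (List; []; _∷_; map)
open import Data.Vec.Functional using () renaming (_∷_ to _∷ᶠ_)
open import Data.List.Membership.Propositional using (_∈_)
open import Data.List.Relation.Unary.Any using (here; there)
open import Data.List.Relation.Unary.AllPairs using (AllPairs; []; _∷_)
open import Data.List.Relation.Unary.All using ([]; _∷_)
open import Function using (_∘_; _⇔_; mk⇔)
open import Relation.Binary using (IsEquivalence; Setoid)
open import Relation.Unary using (Decidable)
import Relation.Binary.Reasoning.Setoid
open import Relation.Binary.Definitions using (tri<; tri≈; tri>)
open import Relation.Binary.PropositionalEquality
  using (_≢_; refl; sym; trans; cong; cong₂; subst; subst₂; module ≡-Reasoning)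
open import Relation.Nullary using (¬_; Dec; yes; no; does)
open import Relation.Nullary.Decidable using (dec-true; dec-false; does-⇔)

module _ {d : ℕ} where

  ≈-refl : {x : Pt d} → x ≈ x
  ≈-refl = + 0 , λ j → sym (ℤP.+-identityʳ _)

  ≈-sym : {x y : Pt d} → x ≈ y → y ≈ x
  ≈-sym {x} {y} (k , x≡y+k) = - k , λ j → begin
      y j             ≡⟨ shift-back (y j) k ⟩
      y j + k + - k   ≡⟨ cong (_+ - k) (x≡y+k j) ⟨
      x j + - k       ∎
    where
    open ≡-Reasoning
    shift-back : ∀ a k → a ≡ a + k + - k
    shift-back = solve-∀

  ≈-trans : {x y z : Pt d} → x ≈ y → y ≈ z → x ≈ z
  ≈-trans {x} {y} {z} (k , x≡y+k) (l , y≡z+l) = l + k , λ j →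
    trans (x≡y+k j) (trans (cong (_+ k) (y≡z+l j)) (ℤP.+-assoc (z j) l k))

  ≈-isEquivalence : IsEquivalence (_≈_ {d})
  ≈-isEquivalence = record
    { refl = ≈-refl ; sym = ≈-sym ; trans = λ {x y z} → ≈-trans {x} {y} {z} }

  ≐⇒≈ : {x y : Pt d} → x ≐ y → x ≈ y
  ≐⇒≈ x≐y = + 0 , λ j → trans (x≐y j) (sym (ℤP.+-identityʳ _))

≈-setoid : ℕ → Setoid _ _
≈-setoid d = record { isEquivalence = ≈-isEquivalence {d} }

module ≈-Reasoning {d : ℕ} = Relation.Binary.Reasoning.Setoid (≈-setoid d)

χ : Bool → ℤ
χ s = if s then + 1 else + 0

χ-injective : ∀ {s s′} → χ s ≡ χ s′ → s ≡ s′
χ-injective {true}  {true}  _ = refl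
χ-injective {false} {false} _ = refl

χ-mono : ∀ {s s′} → (s ≡ true → s′ ≡ true) → χ s ℤ.≤ χ s′
χ-mono {true}  s⇒s′ rewrite s⇒s′ refl = ℤP.≤-refl
χ-mono {false} {true}  _ = +≤+ z≤n
χ-mono {false} {false} _ = ℤP.≤-refl

≤+χ : ∀ a s → a ℤ.≤ a + χ s
≤+χ a true  = ℤP.i≤i+j a (+ 1)
≤+χ a false = ℤP.i≤i+j a (+ 0)

≢+1 : ∀ a → a ≢ a + + 1
≢+1 a eq with +-cancelˡ a (+ 0) (+ 1) (trans (ℤP.+-identityʳ a) eq)
... | ()

zero-or-one : ∀ {δ} → + 0 ℤ.≤ δ → δ ℤ.≤ + 1 → ∃[ s ] δ ≡ χ s
zero-or-one {+ 0}           _ _               = false , refl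
zero-or-one {+ 1}           _ _               = true , refl
zero-or-one {+ suc (suc _)} _ (+≤+ (s≤s ()))
zero-or-one { -[1+ _ ]}     () _

between⇒+χ : ∀ {a x} → a ℤ.≤ x → x ℤ.≤ a + + 1 → ∃[ s ] x ≡ a + χ s
between⇒+χ {a} {x} a≤x x≤a+1 =
  let s , x-a≡χs = zero-or-one (ℤP.i≤j⇒0≤j-i a≤x) x-a≤1 in
  s , trans (split x a) (cong (λ δ → a + δ) x-a≡χs)
  where
  split : ∀ x a → x ≡ a + (x - a)
  split = solve-∀
  cancel : ∀ a → a + + 1 - a ≡ + 1
  cancel = solve-∀
  x-a≤1 : x - a ℤ.≤ + 1
  x-a≤1 = ℤP.≤-trans (ℤP.+-monoˡ-≤ (- a) x≤a+1) (ℤP.≤-reflexive (cancel a))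

-- Staircases

cube : ∀ {d} → Pt d → (Fin d → Bool) → Pt d
cube b S j = b j + χ (S j)

-- The normal form of a small chain: coordinate j steps up at stage τ j.
staircase : ∀ {d i} → Pt d → (Fin d → ℕ) → Fin (suc i) → Pt d
staircase b τ k = cube b (λ j → does (τ j ≤? toℕ k))

Bounded : ∀ {d} → ℕ → (Fin d → ℕ) → Set
Bounded i τ = ∀ j → τ j ℕ.≤ i

Onto : ∀ {d} → ℕ → (Fin d → ℕ) → Set
Onto i τ = ∀ k → k ℕ.≤ i → ∃[ j ] τ j ≡ k

false≢true : false ≢ true
false≢true ()

witness : ∀ {A : Set} (a? : Dec A) → does a? ≡ true → A
witness (yes a) _ = a
witness (no _) ()

χ≤?-mono : ∀ t {m n} → m ℕ.≤ n → χ (does (t ≤? m)) ℤ.≤ χ (does (t ≤? n))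
χ≤?-mono t {m} {n} m≤n =
  χ-mono λ t≤m → dec-true (t ≤? n) (ℕP.≤-trans (witness (t ≤? m) t≤m) m≤n)

module _ {d i : ℕ} (b : Pt d) (τ : Fin d → ℕ) where

  staircase-mono : ∀ {k k′ : Fin (suc i)} → toℕ k ℕ.≤ toℕ k′ →
                   staircase b τ k ≤ᵖ staircase b τ k′
  staircase-mono k≤k′ j = ℤP.+-monoʳ-≤ (b j) (χ≤?-mono (τ j) k≤k′)

  staircase-reached : ∀ {k : Fin (suc i)} {j} → τ j ℕ.≤ toℕ k → staircase b τ k j ≡ b j + + 1
  staircase-reached {k} {j} τj≤k = cong (λ s → b j + χ s) (dec-true (τ j ≤? toℕ k) τj≤k)

  staircase-top : Bounded i τ → ∀ j → staircase b τ (fromℕ i) j ≡ b j + + 1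
  staircase-top bounded j = staircase-reached (subst (τ j ℕ.≤_) (sym (FP.toℕ-fromℕ i)) (bounded j))

  staircase-jump : ∀ {k k′ : Fin (suc i)} {j} → τ j ≡ toℕ k′ → toℕ k ℕ.< toℕ k′ →
                   staircase b τ k j ≢ staircase b τ k′ j
  staircase-jump {k} {k′} {j} τj≡k′ k<k′ eq = false≢true (begin
    false                 ≡⟨ dec-false (τ j ≤? toℕ k) τj≰k ⟨
    does (τ j ≤? toℕ k)   ≡⟨ χ-injective (+-cancelˡ (b j) _ _ eq) ⟩
    does (τ j ≤? toℕ k′)  ≡⟨ dec-true (τ j ≤? toℕ k′) (ℕP.≤-reflexive τj≡k′) ⟩
    true                  ∎)
    where
    open ≡-Reasoning
    τj≰k : ¬ τ j ℕ.≤ toℕ k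
    τj≰k τj≤k = ℕP.<⇒≱ k<k′ (subst (ℕ._≤ toℕ k) τj≡k′ τj≤k)

  staircase-isSmallChain : Bounded i τ → Onto i τ → IsSmallChain i (staircase b τ)
  staircase-isSmallChain bounded onto = step , wrap
    where
    step : ∀ (k : Fin i) → staircase b τ (inject₁ k) ⪇ staircase b τ (suc k)
    step k = staircase-mono (ℕP.<⇒≤ k<1+k) , λ eq → staircase-jump (proj₂ hit) k<1+k (eq (proj₁ hit))
      where
      k<1+k : toℕ (inject₁ k) ℕ.< toℕ (suc k)
      k<1+k = s≤s (ℕP.≤-reflexive (FP.toℕ-inject₁ k))
      hit : ∃[ j ] τ j ≡ toℕ (suc k)
      hit = onto (suc (toℕ k)) (FP.toℕ<n k)
    wrap : staircase b τ (fromℕ i) ⪇ (staircase {i = i} b τ zero +ᵖ 𝟙)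
    wrap = (λ j → ℤP.≤-trans (ℤP.≤-reflexive (staircase-top bounded j))
                   (ℤP.+-monoˡ-≤ (+ 1) (≤+χ (b j) _)))
         , λ eq → ≢+1 (b j + + 1)
             (trans (sym (staircase-top bounded j)) (trans (eq j) (cong (_+ + 1) bottom)))
      where
      j : Fin d
      j = proj₁ (onto 0 z≤n)
      bottom : staircase {i = i} b τ zero j ≡ b j + + 1
      bottom = staircase-reached (ℕP.≤-reflexive (proj₂ (onto 0 z≤n)))

  staircase-differs : ∀ {k k′ : Fin (suc i)} {j} → toℕ k′ ≡ suc (toℕ k) →
                      staircase b τ k j ≢ staircase b τ k′ j → τ j ≡ toℕ k′
  staircase-differs {k} {k′} {j} k′≡1+k ne with τ j ≤? toℕ k
  ... | yes τj≤k = ⊥-elim (ne (cong (λ s → b j + χ s)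
          (trans (dec-true (τ j ≤? toℕ k) τj≤k)
                 (sym (dec-true (τ j ≤? toℕ k′) (ℕP.≤-trans τj≤k k≤k′))))))
    where k≤k′ = subst (toℕ k ℕ.≤_) (sym k′≡1+k) (ℕP.n≤1+n (toℕ k))
  ... | no τj≰k with τ j ≤? toℕ k′
  ...   | yes τj≤k′ = ℕP.≤-antisym τj≤k′ (subst (ℕ._≤ τ j) (sym k′≡1+k) (ℕP.≰⇒> τj≰k))
  ...   | no τj≰k′  = ⊥-elim (ne (cong (λ s → b j + χ s)
          (trans (dec-false (τ j ≤? toℕ k) τj≰k) (sym (dec-false (τ j ≤? toℕ k′) τj≰k′)))))

  staircase-wrap-differs : Bounded i τ → ∀ {j} →
    staircase b τ (fromℕ i) j ≢ staircase {i = i} b τ zero j + + 1 → τ j ≡ 0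
  staircase-wrap-differs bounded {j} ne with τ j ≤? 0
  ... | yes τj≤0 = ℕP.n≤0⇒n≡0 τj≤0
  ... | no τj≰0  = ⊥-elim (ne (trans (staircase-top bounded j)
          (cong (_+ + 1) (sym (trans (cong (λ s → b j + χ s) (dec-false (τ j ≤? 0) τj≰0))
                                     (ℤP.+-identityʳ (b j)))))))

  staircase-≉ : Onto i τ → ∀ {k k′ : Fin (suc i)} → toℕ k ℕ.< toℕ k′ →
                ¬ staircase b τ k ≈ staircase b τ k′
  staircase-≉ onto {k} {k′} k<k′ (c , h) =
    staircase-jump τj₂≡k′ k<k′ (trans (h j₂) (trans (cong (λ c′ → staircase b τ k′ j₂ + c′) (sym 0≡c))
                                                       (ℤP.+-identityʳ _)))
    where
    j₁ j₂ : Fin d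
    j₁ = proj₁ (onto (toℕ k) (FP.toℕ≤pred[n] k))
    j₂ = proj₁ (onto (toℕ k′) (FP.toℕ≤pred[n] k′))
    τj₂≡k′ : τ j₂ ≡ toℕ k′
    τj₂≡k′ = proj₂ (onto (toℕ k′) (FP.toℕ≤pred[n] k′))
    τj₁≤k : τ j₁ ℕ.≤ toℕ k
    τj₁≤k = ℕP.≤-reflexive (proj₂ (onto (toℕ k) (FP.toℕ≤pred[n] k)))
    0≡c : + 0 ≡ c
    0≡c = +-cancelˡ (b j₁ + + 1) (+ 0) c (begin
      b j₁ + + 1 + + 0          ≡⟨ ℤP.+-identityʳ _ ⟩
      b j₁ + + 1                ≡⟨ staircase-reached τj₁≤k ⟨
      staircase b τ k j₁        ≡⟨ h j₁ ⟩
      staircase b τ k′ j₁ + c   ≡⟨ cong (_+ c) (staircase-reached (ℕP.≤-trans τj₁≤k (ℕP.<⇒≤ k<k′))) ⟩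
      b j₁ + + 1 + c            ∎)
      where open ≡-Reasoning

  staircase-distinct : Onto i τ → ∀ {k k′ : Fin (suc i)} →
                       staircase b τ k ≈ staircase b τ k′ → k ≡ k′
  staircase-distinct onto {k} {k′} eq with ℕP.<-cmp (toℕ k) (toℕ k′)
  ... | tri< k<k′ _ _ = ⊥-elim (staircase-≉ onto k<k′ eq)
  ... | tri≈ _ k≡k′ _ = FP.toℕ-injective k≡k′
  ... | tri> _ _ k′<k = ⊥-elim (staircase-≉ onto k′<k (≈-sym eq))

-- Every small chain is a staircase

record Staircase {d : ℕ} (i : ℕ) (z : Fin (suc i) → Pt d) : Set where
  field
    base    : Pt d
    level   : Fin d → ℕ
    bounded : Bounded i level
    onto    : Onto i level
    shape   : ∀ k → z k ≐ staircase base level k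

threshold : ∀ {i} (s : Fin (suc i) → Bool) →
            (∀ {k k′} → k F.≤ k′ → s k ≡ true → s k′ ≡ true) → s (fromℕ i) ≡ true →
            ∃[ t ] (t ℕ.≤ i × ∀ k → s k ≡ does (t ≤? toℕ k))
threshold {i} s mono top = toℕ first , FP.toℕ≤pred[n] first , agree
  where
  smallest : ∃ λ k → s k ≢ false × ((q : F.Fin′ k) → s (F.inject q) ≡ false)
  smallest = FP.¬∀⟶∃¬-smallest (suc i) (λ k → s k ≡ false) (λ k → s k 𝔹.≟ false)
               (λ all-false → false≢true (trans (sym (all-false (fromℕ i))) top))
  first : Fin (suc i)
  first = proj₁ smallest
  agree : ∀ k → s k ≡ does (toℕ first ≤? toℕ k)
  agree k with toℕ first ≤? toℕ k
  ... | yes first≤k = trans (mono first≤k (𝔹.¬-not (proj₁ (proj₂ smallest))))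
                            (sym (dec-true (toℕ first ≤? toℕ k) first≤k))
  ... | no first≰k  =
    trans (subst (λ k′ → s k′ ≡ false) inject-k (proj₂ (proj₂ smallest) (fromℕ< k<first)))
                            (sym (dec-false (toℕ first ≤? toℕ k) first≰k))
    where
    k<first : toℕ k ℕ.< toℕ first
    k<first = ℕP.≰⇒> first≰k
    inject-k : F.inject (fromℕ< k<first) ≡ k
    inject-k = FP.toℕ-injective (trans (FP.toℕ-inject _) (FP.toℕ-fromℕ< k<first))

+χ-mono⁻¹ : ∀ a {s s′} → a + χ s ℤ.≤ a + χ s′ → s ≡ true → s′ ≡ true
+χ-mono⁻¹ a {s′ = true}  _  _    = refl
+χ-mono⁻¹ a {s′ = false} le refl = ⊥-elim (ℤP.<⇒≱ (ℤP.+-monoʳ-< a (ℤ.+<+ (s≤s z≤n))) le)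

module _ {d i : ℕ} {z : Fin (suc i) → Pt d} (small : IsSmallChain i z) where

  smallChain-mono : ∀ {k k′} → k F.≤ k′ → z k ≤ᵖ z k′
  smallChain-mono {k} = FI.<-weakInduction-startingFrom (λ k′ → z k ≤ᵖ z k′) (λ _ → ℤP.≤-refl)
    (λ q zk≤zq j → ℤP.≤-trans (zk≤zq j) (proj₁ (proj₁ small q) j))

  smallChain⇒staircase : Staircase i z
  smallChain⇒staircase = record
    { base = b ; level = level ; bounded = proj₁ ∘ proj₂ ∘ threshold′
    ; onto = onto ; shape = shape }
    where
    top : Fin (suc i)
    top = fromℕ i
    b : Pt d
    b j = z top j - + 1

    z-top : ∀ j → z top j ≡ b j + + 1
    z-top j = shift (z top j)
      where shift : ∀ a → a ≡ a - + 1 + + 1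
            shift = solve-∀

    bits : ∀ k j → ∃[ s ] z k j ≡ b j + χ s
    bits k j = between⇒+χ lower (ℤP.≤-trans (smallChain-mono (FP.≤fromℕ k) j) (ℤP.≤-reflexive (z-top j)))
      where
      wrap : z top j ℤ.≤ z k j + + 1
      wrap = ℤP.≤-trans (proj₁ (proj₂ small) j) (ℤP.+-monoˡ-≤ (+ 1) (smallChain-mono {zero} {k} z≤n j))
      unshift : ∀ a → a + + 1 - + 1 ≡ a
      unshift = solve-∀
      lower : b j ℤ.≤ z k j
      lower = ℤP.≤-trans (ℤP.+-monoˡ-≤ (- + 1) wrap) (ℤP.≤-reflexive (unshift (z k j)))

    bit : Fin (suc i) → Fin d → Bool
    bit k j = proj₁ (bits k j)

    threshold′ : ∀ j → ∃[ t ] (t ℕ.≤ i × ∀ k → bit k j ≡ does (t ≤? toℕ k))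
    threshold′ j = threshold (λ k → bit k j)
      (λ {k} {k′} k≤k′ → +χ-mono⁻¹ (b j)
        (subst₂ ℤ._≤_ (proj₂ (bits k j)) (proj₂ (bits k′ j)) (smallChain-mono k≤k′ j)))
      (χ-injective (+-cancelˡ (b j) _ _ (trans (sym (proj₂ (bits top j))) (z-top j))))

    level : Fin d → ℕ
    level j = proj₁ (threshold′ j)

    shape : ∀ k → z k ≐ staircase b level k
    shape k j = trans (proj₂ (bits k j)) (cong (λ s → b j + χ s) (proj₂ (proj₂ (threshold′ j)) k))

    onto : Onto i level
    onto zero _ =
      let j , ne = FP.¬∀⟶∃¬ d _ (λ j → z top j ℤP.≟ z zero j + + 1) (proj₂ (proj₂ small)) in
      j , staircase-wrap-differs b level (proj₁ ∘ proj₂ ∘ threshold′)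
            (λ eq → ne (trans (shape top j) (trans eq (cong (_+ + 1) (sym (shape zero j))))))
    onto (suc n) 1+n≤i =
      let j , ne = FP.¬∀⟶∃¬ d _ (λ j → z (inject₁ q) j ℤP.≟ z (suc q) j) (proj₂ (proj₁ small q)) in
      j , trans (staircase-differs b level (cong suc (sym (FP.toℕ-inject₁ q)))
                   (λ eq → ne (trans (shape (inject₁ q) j) (trans eq (sym (shape (suc q) j))))))
                (cong suc (FP.toℕ-fromℕ< 1+n≤i))
      where q = fromℕ< 1+n≤i

onto⇒≤ : ∀ {M i} (f : Fin M → ℕ) → Onto i f → suc i ℕ.≤ M
onto⇒≤ {M} {i} f onto = FP.injective⇒≤ section-injective
  where
  section : Fin (suc i) → Fin M
  section k = proj₁ (onto (toℕ k) (FP.toℕ≤pred[n] k))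
  section-injective : ∀ {k k′} → section k ≡ section k′ → k ≡ k′
  section-injective {k} {k′} eq = FP.toℕ-injective
    (trans (sym (proj₂ (onto _ _))) (trans (cong f eq) (proj₂ (onto _ _))))

onto-punchIn : ∀ {M i} (f : Fin (suc M) → ℕ) {x x′} → x′ ≢ x → f x′ ≡ f x →
               Onto i f → Onto i (f ∘ punchIn x)
onto-punchIn f {x} {x′} x′≢x fx′≡fx onto k k≤i with onto k k≤i
... | j , fj≡k with x F.≟ j
...   | yes refl = punchOut (x′≢x ∘ sym) , trans (cong f (FP.punchIn-punchOut _)) (trans fx′≡fx fj≡k)
...   | no x≢j   = punchOut x≢j , trans (cong f (FP.punchIn-punchOut x≢j)) fj≡k

onto⇒injective : ∀ {n} (T : Fin (suc n) → ℕ) → Onto n T → ∀ {j j′} → T j ≡ T j′ → j ≡ j′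
onto⇒injective T onto {j} {j′} Tj≡Tj′ with j F.≟ j′
... | yes j≡j′ = j≡j′
... | no j≢j′  = ⊥-elim (ℕP.1+n≰n (onto⇒≤ (T ∘ punchIn j′) (onto-punchIn T j≢j′ Tj≡Tj′ onto)))

no-two-collisions : ∀ {m} (τ : Fin (suc (suc m)) → ℕ) → Onto m τ → ∀ {x x′ y y′} →
  y ≢ x → x′ ≢ x → τ x′ ≡ τ x → y′ ≢ y → y′ ≢ x → τ y′ ≡ τ y → ⊥
no-two-collisions {m} τ onto {x} {x′} {y} {y′} y≢x x′≢x τx′≡τx y′≢y y′≢x τy′≡τy =
  ℕP.1+n≰n (onto⇒≤ (τ ∘ punchIn x ∘ punchIn y₀)
    (onto-punchIn (τ ∘ punchIn x) y₀′≢y₀ τy₀′≡τy₀ (onto-punchIn τ x′≢x τx′≡τx onto)))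
  where
  y₀ y₀′ : Fin (suc m)
  y₀ = punchOut (y≢x ∘ sym)
  y₀′ = punchOut (y′≢x ∘ sym)
  y₀′≢y₀ : y₀′ ≢ y₀
  y₀′≢y₀ eq = y′≢y
    (trans (sym (FP.punchIn-punchOut _)) (trans (cong (punchIn x) eq) (FP.punchIn-punchOut _)))
  τy₀′≡τy₀ : τ (punchIn x y₀′) ≡ τ (punchIn x y₀)
  τy₀′≡τy₀ = trans (cong τ (FP.punchIn-punchOut _)) (trans τy′≡τy (cong τ (sym (FP.punchIn-punchOut _))))

χ≤?-suc : ∀ t n → χ (does (t ≤? suc n)) ≡ χ (does (t ≤? n)) + χ (does (t ℕ.≟ suc n))
χ≤?-suc zero          n       = refl
χ≤?-suc (suc zero)    zero    = refl
χ≤?-suc (suc (suc t)) zero    = refl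
χ≤?-suc (suc zero)    (suc n) = refl
χ≤?-suc (suc (suc t)) (suc n) = χ≤?-suc (suc t) n

≤?0≡≟0 : ∀ t → does (t ≤? 0) ≡ does (t ℕ.≟ 0)
≤?0≡≟0 zero    = refl
≤?0≡≟0 (suc t) = refl

module _ {n : ℕ} (T : Fin (suc n) → ℕ) (bounded : Bounded n T) (onto : Onto n T) where

  levelPermutation : Permutation′ (suc n)
  levelPermutation = permutation to from to∘from from∘to
    where
    to : Fin (suc n) → Fin (suc n)
    to j = fromℕ< (s≤s (bounded j))
    from : Fin (suc n) → Fin (suc n)
    from k = proj₁ (onto (toℕ k) (FP.toℕ≤pred[n] k))
    toℕ∘to : ∀ j → toℕ (to j) ≡ T j
    toℕ∘to j = FP.toℕ-fromℕ< (s≤s (bounded j))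
    to∘from : ∀ k → to (from k) ≡ k
    to∘from k = FP.toℕ-injective (trans (toℕ∘to (from k)) (proj₂ (onto (toℕ k) _)))
    from∘to : ∀ j → from (to j) ≡ j
    from∘to j = onto⇒injective T onto (trans (proj₂ (onto (toℕ (to j)) _)) (toℕ∘to j))

  toℕ-levelPermutation : ∀ j → toℕ (levelPermutation ⟨$⟩ʳ j) ≡ T j
  toℕ-levelPermutation j = FP.toℕ-fromℕ< (s≤s (bounded j))

  staircase-step : ∀ b k j → staircase b T k j ≡ prev (staircase b T) k j + χ (does (T j ℕ.≟ toℕ k))
  staircase-step b zero j = begin
    b j + χ (does (T j ≤? 0))              ≡⟨ cong (λ s → b j + χ s) (≤?0≡≟0 (T j)) ⟩
    b j + χ (does (T j ℕ.≟ 0))             ≡⟨ cong (_+ χ _) (unshift (b j)) ⟩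
    b j + + 1 - + 1 + χ (does (T j ℕ.≟ 0)) ≡⟨ cong (λ a → a - + 1 + χ _) (staircase-top b T bounded j) ⟨
    prev (staircase b T) zero j + χ (does (T j ℕ.≟ 0)) ∎
    where
    open ≡-Reasoning
    unshift : ∀ a → a ≡ a + + 1 - + 1
    unshift = solve-∀
  staircase-step b (suc k) j = begin
    b j + χ (does (T j ≤? suc (toℕ k)))
      ≡⟨ cong (λ c → b j + c) (χ≤?-suc (T j) (toℕ k)) ⟩
    b j + (χ (does (T j ≤? toℕ k)) + χ (does (T j ℕ.≟ suc (toℕ k))))
      ≡⟨ ℤP.+-assoc (b j) _ _ ⟨
    b j + χ (does (T j ≤? toℕ k)) + χ (does (T j ℕ.≟ suc (toℕ k)))
      ≡⟨ cong (λ t → b j + χ (does (T j ≤? t)) + χ (does (T j ℕ.≟ suc (toℕ k)))) (FP.toℕ-inject₁ k) ⟨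
    prev (staircase b T) (suc k) j + χ (does (T j ℕ.≟ suc (toℕ k)))  ∎
    where open ≡-Reasoning

  staircase-isStdOrientation : ∀ b → IsStdOrientation n (staircase b T ∘ (levelPermutation ⟨$⟩ʳ_))
  staircase-isStdOrientation b = staircase b T , prev⪇ , λ j → levelPermutation ⟨$⟩ʳ j , jump j , ≈-refl
    where
    x : Fin (suc n) → Pt (suc n)
    x = staircase b T
    prev⪇ : ∀ k → prev x k ⪇ x k
    prev⪇ k = (λ j → ℤP.≤-trans (≤+χ _ _) (ℤP.≤-reflexive (sym (staircase-step b k j))))
            , λ eq → ≢+1 (prev x k j) (trans (eq j) (trans (staircase-step b k j)
                       (cong (λ s → prev x k j + χ s) (dec-true (T j ℕ.≟ toℕ k) Tj≡k))))
      where
      j : Fin (suc n)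
      j = proj₁ (onto (toℕ k) (FP.toℕ≤pred[n] k))
      Tj≡k : T j ≡ toℕ k
      Tj≡k = proj₂ (onto (toℕ k) (FP.toℕ≤pred[n] k))
    jump : ∀ j → (x (levelPermutation ⟨$⟩ʳ j) -ᵖ prev x (levelPermutation ⟨$⟩ʳ j)) ≐ e j
    jump j j′ = begin
      x k j′ - prev x k j′                           ≡⟨ cong (_- prev x k j′) (staircase-step b k j′) ⟩
      prev x k j′ + χ (does (T j′ ℕ.≟ toℕ k)) - prev x k j′ ≡⟨ cancel (prev x k j′) _ ⟩
      χ (does (T j′ ℕ.≟ toℕ k))
        ≡⟨ cong χ (does-⇔ same-level (T j′ ℕ.≟ toℕ k) (j F.≟ j′)) ⟩
      e j j′                                         ∎
      where
      open ≡-Reasoning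
      k : Fin (suc n)
      k = levelPermutation ⟨$⟩ʳ j
      cancel : ∀ a c → a + c - a ≡ c
      cancel = solve-∀
      same-level : (T j′ ≡ toℕ k) ⇔ (j ≡ j′)
      same-level = mk⇔ (λ eq → onto⇒injective T onto (trans (sym (toℕ-levelPermutation j)) (sym eq)))
                       (λ { refl → sym (toℕ-levelPermutation j) })

-- After a shift by c 𝟙, x ≤ y ≤ x + 𝟙: the classes of x and y are equal or span an edge.
Adjacent : ∀ {d} → Pt d → Pt d → Set
Adjacent x y = ∃[ c ] ∀ j → ∃[ s ] y j ≡ x j + c + χ s

module _ {d : ℕ} where

  Adjacent-refl : {x : Pt d} → Adjacent x x
  Adjacent-refl {x} = + 0 , λ j → false , sym (trans (ℤP.+-identityʳ _) (ℤP.+-identityʳ _))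

  Adjacent-sym : {x y : Pt d} → Adjacent x y → Adjacent y x
  Adjacent-sym {x} {y} (c , h) = - c - + 1 , λ j → let s , yj≡ = h j in not s , (begin
      x j                                        ≡⟨ shift (x j) c (χ s) ⟩
      x j + c + χ s + (- c - + 1) + (+ 1 - χ s)  ≡⟨ cong (λ a → a + (- c - + 1) + (+ 1 - χ s)) yj≡ ⟨
      y j + (- c - + 1) + (+ 1 - χ s)            ≡⟨ cong (λ a → y j + (- c - + 1) + a) (χ-not s) ⟩
      y j + (- c - + 1) + χ (not s)              ∎)
    where
    open ≡-Reasoning
    shift : ∀ a c s → a ≡ a + c + s + (- c - + 1) + (+ 1 - s)
    shift = solve-∀
    χ-not : ∀ s → + 1 - χ s ≡ χ (not s)
    χ-not true  = refl
    χ-not false = refl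

  Adjacent-respˡ-≈ : {x x′ y : Pt d} → x ≈ x′ → Adjacent x y → Adjacent x′ y
  Adjacent-respˡ-≈ {x} {x′} {y} (k , x≡x′+k) (c , h) = k + c , λ j → let s , yj≡ = h j in s ,
    trans yj≡ (trans (cong (λ a → a + c + χ s) (x≡x′+k j)) (reassoc (x′ j) k c (χ s)))
    where reassoc : ∀ a k c s → a + k + c + s ≡ a + (k + c) + s
          reassoc = solve-∀

  Adjacent-respʳ-≈ : {x y y′ : Pt d} → y ≈ y′ → Adjacent x y → Adjacent x y′
  Adjacent-respʳ-≈ {x} {y} {y′} y≈y′ adj =
    Adjacent-sym {y′} {x} (Adjacent-respˡ-≈ {y} {y′} {x} y≈y′ (Adjacent-sym {x} {y} adj))

  Adjacent-resp-≈ : {x x′ y y′ : Pt d} → x ≈ x′ → y ≈ y′ → Adjacent x y → Adjacent x′ y′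
  Adjacent-resp-≈ {x} {x′} {y} {y′} x≈x′ y≈y′ adj =
    Adjacent-respʳ-≈ {x′} {y} {y′} y≈y′ (Adjacent-respˡ-≈ {x} {x′} {y} x≈x′ adj)

  ≈⇒Adjacent : {x y : Pt d} → x ≈ y → Adjacent x y
  ≈⇒Adjacent {x} {y} x≈y = Adjacent-respʳ-≈ {x} {x} {y} x≈y (Adjacent-refl {x})

  Adjacent⇒≈cube : {x y : Pt d} → Adjacent x y → ∃[ S ] y ≈ cube x S
  Adjacent⇒≈cube {x} {y} (c , h) = proj₁ ∘ h , c , λ j → trans (proj₂ (h j)) (swap (x j) c _)
    where swap : ∀ a c s → a + c + s ≡ a + s + c
          swap = solve-∀

  -- Adjacent cubes over the same base are nested.
  cube-comparable : ∀ {b : Pt d} {U S} → Adjacent (cube b U) (cube b S) → ∀ {j j′} →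
    S j ≡ true → U j ≡ false → S j′ ≡ false → U j′ ≡ true → ⊥
  cube-comparable {b} {U} {S} (c , h) {j} {j′} Sj Uj Sj′ Uj′ with h j | h j′
  ... | s , eq | s′ , eq′ =
    impossible s s′ (trans (sym (cancel c (χ s) (χ s′))) (cong₂ _-_ c+s≡1 c+s′≡-1))
    where
    open ≡-Reasoning
    cancel : ∀ c a b → (c + a) - (c + b) ≡ a - b
    cancel = solve-∀
    c+s≡1 : c + χ s ≡ + 1
    c+s≡1 = +-cancelˡ (b j) _ _ (begin
      b j + (c + χ s)        ≡⟨ ℤP.+-assoc (b j) c (χ s) ⟨
      b j + c + χ s          ≡⟨ cong (λ a → a + c + χ s) (ℤP.+-identityʳ (b j)) ⟨
      b j + + 0 + c + χ s    ≡⟨ cong (λ u → b j + χ u + c + χ s) Uj ⟨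
      cube b U j + c + χ s   ≡⟨ eq ⟨
      cube b S j             ≡⟨ cong (λ u → b j + χ u) Sj ⟩
      b j + + 1              ∎)
    c+s′≡-1 : c + χ s′ ≡ - + 1
    c+s′≡-1 = +-cancelˡ (b j′ + + 1) _ _ (begin
      b j′ + + 1 + (c + χ s′)   ≡⟨ ℤP.+-assoc (b j′ + + 1) c (χ s′) ⟨
      b j′ + + 1 + c + χ s′     ≡⟨ cong (λ u → b j′ + χ u + c + χ s′) Uj′ ⟨
      cube b U j′ + c + χ s′    ≡⟨ eq′ ⟨
      cube b S j′               ≡⟨ cong (λ u → b j′ + χ u) Sj′ ⟩
      b j′ + + 0                ≡⟨ shift (b j′) ⟩
      b j′ + + 1 + - + 1        ∎)
      where shift : ∀ a → a + + 0 ≡ a + + 1 + - + 1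
            shift = solve-∀
    impossible : ∀ s s′ → χ s - χ s′ ≢ + 1 - - + 1
    impossible true  true  ()
    impossible true  false ()
    impossible false true  ()
    impossible false false ()

between⇒Adjacent : ∀ {d} {x y : Pt d} → x ≤ᵖ y → y ≤ᵖ (x +ᵖ 𝟙) → Adjacent x y
between⇒Adjacent {x = x} {y} x≤y y≤x+1 = + 0 , λ j →
  let s , yj≡ = between⇒+χ (x≤y j) (y≤x+1 j) in
  s , trans yj≡ (cong (_+ χ s) (sym (ℤP.+-identityʳ (x j))))

module _ {d i : ℕ} (b : Pt d) (τ : Fin d → ℕ) where

  staircase-adjacent-≤ : ∀ {k k′ : Fin (suc i)} → toℕ k ℕ.≤ toℕ k′ →
                         Adjacent (staircase b τ k) (staircase b τ k′)
  staircase-adjacent-≤ k≤k′ = between⇒Adjacent (staircase-mono b τ k≤k′) λ j →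
    ℤP.≤-trans (ℤP.+-monoʳ-≤ (b j) (χ-mono {s′ = true} λ _ → refl)) (ℤP.+-monoˡ-≤ (+ 1) (≤+χ (b j) _))

  staircase-adjacent : ∀ (k k′ : Fin (suc i)) → Adjacent (staircase b τ k) (staircase b τ k′)
  staircase-adjacent k k′ with ℕP.≤-total (toℕ k) (toℕ k′)
  ... | inj₁ k≤k′ = staircase-adjacent-≤ k≤k′
  ... | inj₂ k′≤k = Adjacent-sym {x = staircase b τ k′} (staircase-adjacent-≤ k′≤k)

simplex-staircase : ∀ {d i} {u : Fin (suc i) → Pt d} (σ : IsSimplex i u) → Staircase i (proj₁ σ)
simplex-staircase σ = smallChain⇒staircase (proj₁ (proj₂ (proj₂ σ)))

module Simplex {d i : ℕ} {u : Fin (suc i) → Pt d} (σ : IsSimplex i u) (st : Staircase i (proj₁ σ)) where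

  π : Permutation′ (suc i)
  π = proj₁ (proj₂ σ)

  open Staircase st public

  vertex≈ : ∀ k → u k ≈ staircase base level (π ⟨$⟩ʳ k)
  vertex≈ k = begin
    u k                              ≈⟨ proj₂ (proj₂ (proj₂ σ)) k ⟩
    proj₁ σ (π ⟨$⟩ʳ k)              ≈⟨ ≐⇒≈ (shape (π ⟨$⟩ʳ k)) ⟩
    staircase base level (π ⟨$⟩ʳ k) ∎
    where open ≈-Reasoning

  adjacent : ∀ k k′ → Adjacent (u k) (u k′)
  adjacent k k′ =
    Adjacent-resp-≈ {x = staircase base level (π ⟨$⟩ʳ k)} {u k} {staircase base level (π ⟨$⟩ʳ k′)} {u k′}
      (≈-sym {x = u k} (vertex≈ k)) (≈-sym {x = u k′} (vertex≈ k′))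
      (staircase-adjacent base level (π ⟨$⟩ʳ k) (π ⟨$⟩ʳ k′))

  distinct : ∀ {k k′} → u k ≈ u k′ → k ≡ k′
  distinct {k} {k′} uk≈uk′ = trans (sym (inverseˡ π)) (trans (cong (π ⟨$⟩ˡ_) πk≡πk′) (inverseˡ π))
    where
    πk≡πk′ : π ⟨$⟩ʳ k ≡ π ⟨$⟩ʳ k′
    πk≡πk′ = staircase-distinct base level onto (begin
      staircase base level (π ⟨$⟩ʳ k)  ≈⟨ vertex≈ k ⟨
      u k                              ≈⟨ uk≈uk′ ⟩
      u k′                             ≈⟨ vertex≈ k′ ⟩
      staircase base level (π ⟨$⟩ʳ k′) ∎)
      where open ≈-Reasoning

simplex-permute : ∀ {d i} {u : Fin (suc i) → Pt d} → IsSimplex i u →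
                  (ρ : Permutation′ (suc i)) → IsSimplex i (u ∘ (ρ ⟨$⟩ʳ_))
simplex-permute (z , π , small , u≈z) ρ = z , ρ ∘ₚ π , small , λ k → u≈z (ρ ⟨$⟩ʳ k)

-- The parity of the particular decomposition returned by decompose; no independence of the
-- decomposition is needed.
parity : ∀ {n} → TranspositionList n → ℤ
parity []             = + 1
parity ((a , b) ∷ ts) = if does (a FP.≟ b) then parity ts else - parity ts

sign : ∀ {n} → Permutation′ n → ℤ
sign π = parity (decompose π)

transpose-self : ∀ {n} (a k : Fin n) → transpose a a ⟨$⟩ʳ k ≡ k
transpose-self a k with k FP.≟ a
... | yes k≡a = sym k≡a
... | no k≢a rewrite dec-false (k FP.≟ a) k≢a = refl

module _ {d i : ℕ} {β : (Fin (suc i) → Pt d) → ℤ} (chain : IsChain d i β) where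

  chain-eval : ∀ ts (u : Fin (suc i) → Pt d) → IsSimplex i u →
               β (u ∘ (eval ts ⟨$⟩ʳ_)) ≡ parity ts * β u
  chain-eval []             u σ = sym (ℤP.*-identityˡ (β u))
  chain-eval ((a , b) ∷ ts) u σ with a FP.≟ b
  ... | yes refl = trans (sym (proj₁ chain u′ (u′ ∘ (transpose a a ⟨$⟩ʳ_)) σ′ λ k →
                           ≐⇒≈ λ j → cong (λ q → u′ q j) (sym (transpose-self a k))))
                         (chain-eval ts u σ)
    where
    u′ : Fin (suc i) → Pt d
    u′ = u ∘ (eval ts ⟨$⟩ʳ_)
    σ′ : IsSimplex i u′
    σ′ = simplex-permute σ (eval ts)
  ... | no a≢b = begin
    β (u′ ∘ (transpose a b ⟨$⟩ʳ_)) ≡⟨ proj₂ chain u′ (simplex-permute σ (eval ts)) a b a≢b ⟩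
    - β u′                          ≡⟨ cong -_ (chain-eval ts u σ) ⟩
    - (parity ts * β u)             ≡⟨ ℤP.neg-distribˡ-* (parity ts) (β u) ⟩
    - parity ts * β u               ∎
    where
    open ≡-Reasoning
    u′ : Fin (suc i) → Pt d
    u′ = u ∘ (eval ts ⟨$⟩ʳ_)

  chain-permute : ∀ (u : Fin (suc i) → Pt d) → IsSimplex i u → ∀ π →
                  β (u ∘ (π ⟨$⟩ʳ_)) ≡ sign π * β u
  chain-permute u σ π = trans
    (proj₁ chain (u ∘ (π ⟨$⟩ʳ_)) (u ∘ (eval (decompose π) ⟨$⟩ʳ_)) (simplex-permute σ π)
       λ k → ≐⇒≈ λ j → cong (λ q → u q j) (sym (eval-decompose π k)))
    (chain-eval (decompose π) u σ)

module _ {d : ℕ} where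

  private
    ≉-same-class : ∀ (x y r : Pt d) → ¬ x ≈ y → x ≈ r → y ≈ r → ⊥
    ≉-same-class x y r x≉y x≈r y≈r = x≉y (≈-trans {x = x} {r} {y} x≈r (≈-sym {x = y} {r} y≈r))

  sum-over-two-classes : ∀ (f : Pt d → ℤ) {P Q : Pt d} (L : List (Pt d)) → ¬ P ≈ Q →
    AllPairs (λ x y → ¬ x ≈ y) L →
    (∀ {w} → w ∈ L → (w ≈ P × f w ≡ f P) ⊎ (w ≈ Q × f w ≡ f Q)) →
    ∃[ w ] (w ∈ L × P ≈ w) → ∃[ w ] (w ∈ L × Q ≈ w) →
    sumℤ (map f L) ≡ f P + f Q
  sum-over-two-classes f [] _ _ _ (_ , () , _) _
  sum-over-two-classes f {P} {Q} (x ∷ []) P≉Q _ _ (_ , here refl , P≈x) (_ , here refl , Q≈x) =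
    ⊥-elim (P≉Q (≈-trans {x = P} {x} {Q} P≈x (≈-sym {x = Q} {x} Q≈x)))
  sum-over-two-classes f {P} {Q} (x ∷ y ∷ []) _ ((x≉y ∷ []) ∷ _) class _ _
    with class (here refl) | class (there (here refl))
  ... | inj₁ (x≈P , fx) | inj₁ (y≈P , fy) = ⊥-elim (≉-same-class x y P x≉y x≈P y≈P)
  ... | inj₂ (x≈Q , fx) | inj₂ (y≈Q , fy) = ⊥-elim (≉-same-class x y Q x≉y x≈Q y≈Q)
  ... | inj₁ (_ , fx)   | inj₂ (_ , fy)   =
    trans (cong₂ _+_ fx (trans (ℤP.+-identityʳ (f y)) fy)) refl
  ... | inj₂ (_ , fx)   | inj₁ (_ , fy)   =
    trans (cong₂ _+_ fx (trans (ℤP.+-identityʳ (f y)) fy)) (ℤP.+-comm (f Q) (f P))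
  sum-over-two-classes f {P} {Q} (x ∷ y ∷ z ∷ _) _ ((x≉y ∷ x≉z ∷ _) ∷ (y≉z ∷ _) ∷ _) class _ _
    with class (here refl) | class (there (here refl)) | class (there (there (here refl)))
  ... | inj₁ (x≈P , _) | inj₁ (y≈P , _) | _              = ⊥-elim (≉-same-class x y P x≉y x≈P y≈P)
  ... | inj₂ (x≈Q , _) | inj₂ (y≈Q , _) | _              = ⊥-elim (≉-same-class x y Q x≉y x≈Q y≈Q)
  ... | inj₁ (x≈P , _) | inj₂ _         | inj₁ (z≈P , _) = ⊥-elim (≉-same-class x z P x≉z x≈P z≈P)
  ... | inj₂ (x≈Q , _) | inj₁ _         | inj₂ (z≈Q , _) = ⊥-elim (≉-same-class x z Q x≉z x≈Q z≈Q)
  ... | inj₁ _         | inj₂ (y≈Q , _) | inj₂ (z≈Q , _) = ⊥-elim (≉-same-class y z Q y≉z y≈Q z≈Q)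
  ... | inj₂ _         | inj₁ (y≈P , _) | inj₁ (z≈P , _) = ⊥-elim (≉-same-class y z P y≉z y≈P z≈P)

argmax : ∀ {n} (f : Fin n → ℕ) {P : Fin n → Set} → Decidable P → ∃ P →
         ∃[ j ] (P j × ∀ j′ → P j′ → f j′ ℕ.≤ f j)
argmax {zero}  f P? (() , _)
argmax {suc n} f {P} P? ∃P with FP.any? (P? ∘ suc)
... | no ¬tail = zero , P-head ∃P , λ { zero _ → ℕP.≤-refl ; (suc j) Pj → ⊥-elim (¬tail (j , Pj)) }
  where
  P-head : ∃ P → P zero
  P-head (zero , P0)  = P0
  P-head (suc j , Pj) = ⊥-elim (¬tail (j , Pj))
... | yes ∃tail with argmax (f ∘ suc) (P? ∘ suc) ∃tail | P? zero
...   | j , Pj , max | no ¬P0 = suc j , Pj , λ { zero P0 → ⊥-elim (¬P0 P0) ; (suc j′) → max j′ }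
...   | j , Pj , max | yes P0 with f zero ℕ.≤? f (suc j)
...     | yes f0≤fj = suc j , Pj , λ { zero _ → f0≤fj ; (suc j′) → max j′ }
...     | no f0≰fj  = zero , P0 , λ { zero _ → ℕP.≤-refl
                                    ; (suc j′) Pj′ → ℕP.≤-trans (max j′ Pj′) (ℕP.<⇒≤ (ℕP.≰⇒> f0≰fj)) }

record LevelSplit {d : ℕ} (τ : Fin d → ℕ) (S : Fin d → Bool) : Set where
  field
    inner outer : Fin d
    inner-in    : S inner ≡ true
    outer-out   : S outer ≡ false
    same-level  : τ outer ≡ τ inner
    below       : ∀ j → τ j ℕ.< τ inner → S j ≡ true
    above       : ∀ j → τ inner ℕ.< τ j → S j ≡ false

module _ {d i : ℕ} (b : Pt d) (τ : Fin d → ℕ) (bounded : Bounded i τ) (S : Fin d → Bool)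
         (adjacent : ∀ k → Adjacent (staircase {i = i} b τ k) (cube b S))
         (new : ∀ k → ¬ cube b S ≈ staircase {i = i} b τ k) where

  private
    vertexAt : Fin d → Fin (suc i)
    vertexAt j = fromℕ< (s≤s (bounded j))

    toℕ-vertexAt : ∀ j → toℕ (vertexAt j) ≡ τ j
    toℕ-vertexAt j = FP.toℕ-fromℕ< (s≤s (bounded j))

    crossing : ∀ j {j′} → S j ≡ true → τ j′ ℕ.< τ j → S j′ ≡ false → ⊥
    crossing j {j′} Sj τj′<τj Sj′ =
      cube-comparable {b = b} {U = λ j → does (τ j ≤? toℕ (vertexAt j′))} {S} (adjacent (vertexAt j′)) Sj
      (dec-false (τ j ≤? toℕ (vertexAt j′)) (ℕP.<⇒≱ (subst (ℕ._< τ j) (sym (toℕ-vertexAt j′)) τj′<τj)))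
      Sj′ (dec-true (τ j′ ≤? toℕ (vertexAt j′)) (ℕP.≤-reflexive (sym (toℕ-vertexAt j′))))

    nonempty : ∃[ j ] S j ≡ true
    nonempty =
      let j , Sj≢false = FP.¬∀⟶∃¬ d (λ j → S j ≡ false) (λ j → S j 𝔹.≟ false) not-all-false in
      j , 𝔹.¬-not Sj≢false
      where
      not-all-false : ¬ (∀ j → S j ≡ false)
      not-all-false all-false = new (fromℕ i) (- + 1 , λ j → begin
        b j + χ (S j)                    ≡⟨ cong (λ s → b j + χ s) (all-false j) ⟩
        b j + + 0                        ≡⟨ shift (b j) ⟩
        b j + + 1 - + 1                  ≡⟨ cong (_- + 1) (staircase-top b τ bounded j) ⟨
        staircase b τ (fromℕ i) j - + 1  ∎)
        where
        open ≡-Reasoning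
        shift : ∀ a → a + + 0 ≡ a + + 1 - + 1
        shift = solve-∀

  levelSplit : LevelSplit τ S
  levelSplit = record
    { inner = j₁ ; outer = j₂ ; inner-in = Sj₁ ; outer-out = Sj₂ ; same-level = same-level
    ; below = below ; above = above }
    where
    maximal : ∃[ j ] (S j ≡ true × ∀ j′ → S j′ ≡ true → τ j′ ℕ.≤ τ j)
    maximal = argmax τ (λ j → S j 𝔹.≟ true) nonempty
    j₁ : Fin d
    j₁ = proj₁ maximal
    Sj₁ : S j₁ ≡ true
    Sj₁ = proj₁ (proj₂ maximal)
    max : ∀ j → S j ≡ true → τ j ℕ.≤ τ j₁
    max = proj₂ (proj₂ maximal)
    K : Fin (suc i)
    K = vertexAt j₁

    S⊆K : ∀ j → S j ≡ true → does (τ j ≤? toℕ K) ≡ true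
    S⊆K j Sj = dec-true (τ j ≤? toℕ K) (subst (τ j ℕ.≤_) (sym (toℕ-vertexAt j₁)) (max j Sj))

    differ : ∃[ j ] S j ≢ does (τ j ≤? toℕ K)
    differ = FP.¬∀⟶∃¬ d (λ j → S j ≡ does (τ j ≤? toℕ K)) (λ j → S j 𝔹.≟ does (τ j ≤? toℕ K))
               (λ agree → new K (≐⇒≈ λ j → cong (λ s → b j + χ s) (agree j)))
    j₂ : Fin d
    j₂ = proj₁ differ

    Sj₂ : S j₂ ≡ false
    Sj₂ = 𝔹.¬-not (λ Sj₂ → proj₂ differ (trans Sj₂ (sym (S⊆K j₂ Sj₂))))

    τj₂≤τj₁ : τ j₂ ℕ.≤ τ j₁
    τj₂≤τj₁ = subst (τ j₂ ℕ.≤_) (toℕ-vertexAt j₁)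
      (witness (τ j₂ ≤? toℕ K) (trans (𝔹.¬-not (proj₂ differ ∘ sym)) (cong not Sj₂)))

    same-level : τ j₂ ≡ τ j₁
    same-level = ℕP.≤-antisym τj₂≤τj₁ (ℕP.≮⇒≥ λ τj₂<τj₁ → crossing j₁ Sj₁ τj₂<τj₁ Sj₂)

    below : ∀ j → τ j ℕ.< τ j₁ → S j ≡ true
    below j τj<τj₁ = 𝔹.¬-not (crossing j₁ Sj₁ τj<τj₁)

    above : ∀ j → τ j₁ ℕ.< τ j → S j ≡ false
    above j τj₁<τj = 𝔹.¬-not λ Sj → ℕP.<⇒≱ τj₁<τj (max j Sj)

toℕ-punchIn-< : ∀ {n} (G : Fin (suc n)) (l : Fin n) → toℕ l ℕ.< toℕ G → toℕ (punchIn G l) ≡ toℕ l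
toℕ-punchIn-< (suc G) zero    _         = refl
toℕ-punchIn-< (suc G) (suc l) (s≤s l<G) = cong suc (toℕ-punchIn-< G l l<G)

toℕ-punchIn-≥ : ∀ {n} (G : Fin (suc n)) (l : Fin n) → toℕ G ℕ.≤ toℕ l → toℕ (punchIn G l) ≡ suc (toℕ l)
toℕ-punchIn-≥ zero    l       _         = refl
toℕ-punchIn-≥ (suc G) (suc l) (s≤s G≤l) = cong suc (toℕ-punchIn-≥ G l G≤l)

transpose-left : ∀ {n} (a b : Fin n) → transpose a b ⟨$⟩ʳ a ≡ b
transpose-left a b rewrite dec-true (a FP.≟ a) refl = refl

transpose-right : ∀ {n} (a b : Fin n) → a ≢ b → transpose a b ⟨$⟩ʳ b ≡ a
transpose-right a b a≢b rewrite dec-false (b FP.≟ a) (a≢b ∘ sym) | dec-true (b FP.≟ b) refl = refl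

transpose-other : ∀ {n} (a b k : Fin n) → k ≢ a → k ≢ b → transpose a b ⟨$⟩ʳ k ≡ k
transpose-other a b k k≢a k≢b rewrite dec-false (k FP.≟ a) k≢a | dec-false (k FP.≟ b) k≢b = refl

does-both : ∀ {A B : Set} (a? : Dec A) (b? : Dec B) → A → B → does a? ≡ does b?
does-both a? b? a b = trans (dec-true a? a) (sym (dec-true b? b))

does-neither : ∀ {A B : Set} (a? : Dec A) (b? : Dec B) → ¬ A → ¬ B → does a? ≡ does b?
does-neither a? b? ¬a ¬b = trans (dec-false a? ¬a) (sym (dec-false b? ¬b))

-- The two cofaces of a codimension-one simplex

module CodimOne {m : ℕ} (b : Pt (suc (suc m))) (τ : Fin (suc (suc m)) → ℕ)
                (bounded : Bounded m τ) (onto : Onto m τ) where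

  -- Kept abstract so that conversion checking never unfolds the pigeonhole search.
  abstract
   collision : ∃₂ λ a a′ → a ≢ a′ × τ a′ ≡ τ a
   collision with FP.pigeonhole (ℕP.n<1+n (suc m)) (λ j → fromℕ< (s≤s (bounded j)))
   ... | a , a′ , a<a′ , eq = a , a′ , (λ a≡a′ → ℕP.<-irrefl (cong toℕ a≡a′) a<a′) ,
     trans (sym (FP.toℕ-fromℕ< _)) (trans (cong toℕ (sym eq)) (FP.toℕ-fromℕ< _))

  a a′ : Fin (suc (suc m))
  a  = proj₁ collision
  a′ = proj₁ (proj₂ collision)

  a≢a′ : a ≢ a′
  a≢a′ = proj₁ (proj₂ (proj₂ collision))

  G : Fin (suc (suc m))
  G = fromℕ< (s≤s (ℕP.m≤n⇒m≤1+n (bounded a)))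

  g : ℕ
  g = toℕ G

  τa≡g : τ a ≡ g
  τa≡g = sym (FP.toℕ-fromℕ< _)

  τa′≡g : τ a′ ≡ g
  τa′≡g = trans (proj₂ (proj₂ (proj₂ collision))) τa≡g

  g≤τa : g ℕ.≤ τ a
  g≤τa = ℕP.≤-reflexive (sym τa≡g)

  g≤τa′ : g ℕ.≤ τ a′
  g≤τa′ = ℕP.≤-reflexive (sym τa′≡g)

  collision-unique : ∀ {j j′} → j′ ≢ j → τ j′ ≡ τ j → j ≡ a ⊎ j ≡ a′
  collision-unique {j} {j′} j′≢j τj′≡τj with j F.≟ a | j F.≟ a′
  ... | yes j≡a | _        = inj₁ j≡a
  ... | no _    | yes j≡a′ = inj₂ j≡a′
  ... | no j≢a  | no j≢a′ with j′ F.≟ a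
  ...   | yes refl = ⊥-elim (no-two-collisions τ onto {x = a′} {x′ = a} {y = j} {y′ = a}
                       j≢a′ a≢a′ (trans τa≡g (sym τa′≡g)) j′≢j a≢a′ τj′≡τj)
  ...   | no j′≢a  = ⊥-elim (no-two-collisions τ onto {x = a} {x′ = a′} {y = j} {y′ = j′}
                       j≢a (a≢a′ ∘ sym) (trans τa′≡g (sym τa≡g)) j′≢j j′≢a τj′≡τj)

  fiber-pair : ∀ {j j′ j″} → j′ ≢ j → τ j′ ≡ τ j → j″ ≢ j → τ j″ ≡ τ j → j″ ≡ j′
  fiber-pair {j} {j′} {j″} j′≢j τj′≡τj j″≢j τj″≡τj with j″ F.≟ j′
  ... | yes j″≡j′ = j″≡j′
  ... | no j″≢j′  = ⊥-elim (no-two-collisions τ onto {x = j} {x′ = j′} {y = j″} {y′ = j′}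
                      j″≢j j′≢j τj′≡τj (j″≢j′ ∘ sym) j′≢j (trans τj′≡τj (sym τj″≡τj)))

  -- The levels of the coface through apex c: c keeps level g, every other coordinate of level
  -- at least g moves up by one.
  refine : Fin (suc (suc m)) → Fin (suc (suc m)) → ℕ
  refine c j = if does (τ j <? g) then τ j else if does (j F.≟ c) then g else suc (τ j)

  private
    refine-≮ : ∀ c {j} → ¬ τ j ℕ.< g → refine c j ≡ (if does (j F.≟ c) then g else suc (τ j))
    refine-≮ c {j} τj≮g =
      cong (λ s → if s then τ j else if does (j F.≟ c) then g else suc (τ j)) (dec-false (τ j <? g) τj≮g)

  refine-< : ∀ c {j} → τ j ℕ.< g → refine c j ≡ τ j
  refine-< c {j} τj<g =
    cong (λ s → if s then τ j else if does (j F.≟ c) then g else suc (τ j)) (dec-true (τ j <? g) τj<g)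

  refine-self : ∀ c → g ℕ.≤ τ c → refine c c ≡ g
  refine-self c g≤τc = trans (refine-≮ c (ℕP.≤⇒≯ g≤τc))
    (cong (λ s → if s then g else suc (τ c)) (dec-true (c F.≟ c) refl))

  refine-> : ∀ c {j} → j ≢ c → g ℕ.≤ τ j → refine c j ≡ suc (τ j)
  refine-> c {j} j≢c g≤τj = trans (refine-≮ c (ℕP.≤⇒≯ g≤τj))
    (cong (λ s → if s then g else suc (τ j)) (dec-false (j F.≟ c) j≢c))

  data RefineView (c j : Fin (suc (suc m))) : Set where
    lower : τ j ℕ.< g → refine c j ≡ τ j → RefineView c j
    split : g ℕ.≤ τ j → j ≡ c → refine c j ≡ g → RefineView c j
    upper : g ℕ.≤ τ j → j ≢ c → refine c j ≡ suc (τ j) → RefineView c j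

  refine-view : ∀ c j → RefineView c j
  refine-view c j with τ j <? g | j F.≟ c
  ... | yes τj<g | _        = lower τj<g (refine-< c τj<g)
  ... | no τj≮g  | yes refl = split (ℕP.≮⇒≥ τj≮g) refl (refine-self c (ℕP.≮⇒≥ τj≮g))
  ... | no τj≮g  | no j≢c   = upper (ℕP.≮⇒≥ τj≮g) j≢c (refine-> c j≢c (ℕP.≮⇒≥ τj≮g))

  refine-bounded : ∀ c → Bounded (suc m) (refine c)
  refine-bounded c j with refine-view c j
  ... | lower _ eq   = subst (ℕ._≤ suc m) (sym eq) (ℕP.m≤n⇒m≤1+n (bounded j))
  ... | split _ _ eq = subst (ℕ._≤ suc m) (sym eq) (FP.toℕ≤pred[n] G)
  ... | upper _ _ eq = subst (ℕ._≤ suc m) (sym eq) (s≤s (bounded j))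

  g≤m : g ℕ.≤ m
  g≤m = subst (ℕ._≤ m) τa≡g (bounded a)

  refine-onto : ∀ {c c′} → c′ ≢ c → τ c ≡ g → τ c′ ≡ g → Onto (suc m) (refine c)
  refine-onto {c} {c′} c′≢c τc≡g τc′≡g k k≤1+m with ℕP.<-cmp k g
  ... | tri< k<g _ _ =
    let j , τj≡k = onto k (ℕP.≤-trans (ℕP.<⇒≤ k<g) g≤m) in
    j , trans (refine-< c (subst (ℕ._< g) (sym τj≡k) k<g)) τj≡k
  ... | tri≈ _ refl _ = c , refine-self c (ℕP.≤-reflexive (sym τc≡g))
  ... | tri> _ _ (s≤s {n = k′} g≤k′) with k′ ℕ.≟ g
  ...   | yes refl = c′ , trans (refine-> c c′≢c (ℕP.≤-reflexive (sym τc′≡g))) (cong suc τc′≡g)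
  ...   | no k′≢g  =
    let j , τj≡k′ = onto k′ (ℕ.s≤s⁻¹ k≤1+m) in
    j , trans (refine-> c (λ j≡c → k′≢g (trans (sym τj≡k′) (trans (cong τ j≡c) τc≡g)))
                        (subst (g ℕ.≤_) (sym τj≡k′) g≤k′))
              (cong suc τj≡k′)

  private
    refine-≤?-below : ∀ {c j t} → t ℕ.< g → RefineView c j → does (refine c j ≤? t) ≡ does (τ j ≤? t)
    refine-≤?-below t<g (lower _ eq) = cong (λ r → does (r ≤? _)) eq
    refine-≤?-below {c} {j} {t} t<g (split g≤τj _ eq) = does-neither (refine c j ≤? t) (τ j ≤? t)
      (λ r≤t → ℕP.<⇒≱ t<g (subst (ℕ._≤ t) eq r≤t))
      (λ τj≤t → ℕP.<⇒≱ t<g (ℕP.≤-trans g≤τj τj≤t))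
    refine-≤?-below {c} {j} {t} t<g (upper g≤τj _ eq) = does-neither (refine c j ≤? t) (τ j ≤? t)
      (λ r≤t → ℕP.<⇒≱ t<g (ℕP.≤-trans g≤τj (ℕP.<⇒≤ (subst (ℕ._≤ t) eq r≤t))))
      (λ τj≤t → ℕP.<⇒≱ t<g (ℕP.≤-trans g≤τj τj≤t))

    refine-≤?-above : ∀ {c j t} → τ c ≡ g → g ℕ.≤ t → RefineView c j →
                      does (refine c j ≤? suc t) ≡ does (τ j ≤? t)
    refine-≤?-above {c} {j} {t} _ g≤t (lower τj<g eq) = does-both (refine c j ≤? suc t) (τ j ≤? t)
      (subst (ℕ._≤ suc t) (sym eq) (ℕP.m≤n⇒m≤1+n (ℕP.≤-trans (ℕP.<⇒≤ τj<g) g≤t)))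
      (ℕP.≤-trans (ℕP.<⇒≤ τj<g) g≤t)
    refine-≤?-above {c} {j} {t} τc≡g g≤t (split _ refl eq) = does-both (refine c j ≤? suc t) (τ j ≤? t)
      (subst (ℕ._≤ suc t) (sym eq) (ℕP.m≤n⇒m≤1+n g≤t))
      (subst (ℕ._≤ t) (sym τc≡g) g≤t)
    refine-≤?-above {c} {j} {t} _ _ (upper _ _ eq) =
      trans (cong (λ r → does (r ≤? suc t)) eq)
            (does-⇔ (mk⇔ ℕ.s≤s⁻¹ s≤s) (suc (τ j) ≤? suc t) (τ j ≤? t))

  refine-punchIn : ∀ c → τ c ≡ g → ∀ l j →
                   does (refine c j ≤? toℕ (punchIn G l)) ≡ does (τ j ≤? toℕ l)
  refine-punchIn c τc≡g l j with ℕP.<-≤-connex (toℕ l) g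
  ... | inj₁ l<g = trans (cong (λ t → does (refine c j ≤? t)) (toℕ-punchIn-< G l l<g))
                         (refine-≤?-below l<g (refine-view c j))
  ... | inj₂ g≤l = trans (cong (λ t → does (refine c j ≤? t)) (toℕ-punchIn-≥ G l g≤l))
                         (refine-≤?-above τc≡g g≤l (refine-view c j))

  refine-swap : ∀ j → refine a′ (transpose a a′ ⟨$⟩ʳ j) ≡ refine a j
  refine-swap j = by-cases (j F.≟ a) (j F.≟ a′)
    where
    same : j ≢ a → j ≢ a′ → RefineView a′ j → RefineView a j → refine a′ j ≡ refine a j
    same _   _    (lower _ eq)     (lower _ eq′)    = trans eq (sym eq′)
    same _   _    (upper _ _ eq)   (upper _ _ eq′)  = trans eq (sym eq′)
    same _   _    (lower τj<g _)   (upper g≤τj _ _) = ⊥-elim (ℕP.<⇒≱ τj<g g≤τj)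
    same _   _    (upper g≤τj _ _) (lower τj<g _)   = ⊥-elim (ℕP.<⇒≱ τj<g g≤τj)
    same _   j≢a′ (split _ j≡a′ _) _                = ⊥-elim (j≢a′ j≡a′)
    same j≢a _    _                (split _ j≡a _)  = ⊥-elim (j≢a j≡a)
    by-cases : Dec (j ≡ a) → Dec (j ≡ a′) → refine a′ (transpose a a′ ⟨$⟩ʳ j) ≡ refine a j
    by-cases (yes refl) _ = trans (cong (refine a′) (transpose-left a a′))
      (trans (refine-self a′ g≤τa′) (sym (refine-self a g≤τa)))
    by-cases (no _) (yes refl) = trans (cong (refine a′) (transpose-right a a′ a≢a′))
      (trans (refine-> a′ a≢a′ g≤τa)
        (trans (cong suc (trans τa≡g (sym τa′≡g))) (sym (refine-> a (a≢a′ ∘ sym) g≤τa′))))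
    by-cases (no j≢a) (no j≢a′) = trans (cong (refine a′) (transpose-other a a′ j j≢a j≢a′))
      (same j≢a j≢a′ (refine-view a′ j) (refine-view a j))

  apex : Fin (suc (suc m)) → Pt (suc (suc m))
  apex c = staircase b (refine c) G

  apex-≉ : ¬ apex a ≈ apex a′
  apex-≉ eq = cube-comparable {b = b} {U = bits a} {S = bits a′}
    (≈⇒Adjacent {x = apex a} {apex a′} eq)
    (dec-true (refine a′ a′ ≤? g) (ℕP.≤-reflexive (refine-self a′ g≤τa′)))
    (dec-false (refine a a′ ≤? g) (λ r≤g → ℕP.1+n≰n (subst (ℕ._≤ g)
      (trans (refine-> a (a≢a′ ∘ sym) g≤τa′) (cong suc τa′≡g)) r≤g)))
    (dec-false (refine a′ a ≤? g) (λ r≤g → ℕP.1+n≰n (subst (ℕ._≤ g)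
      (trans (refine-> a′ a≢a′ g≤τa) (cong suc τa≡g)) r≤g)))
    (dec-true (refine a a ≤? g) (ℕP.≤-reflexive (refine-self a g≤τa)))
    where
    bits : Fin (suc (suc m)) → Fin (suc (suc m)) → Bool
    bits c j = does (refine c j ≤? g)

  module _ {S : Fin (suc (suc m)) → Bool} (sp : LevelSplit τ S) where
    open LevelSplit sp

    private
      outer≢inner : outer ≢ inner
      outer≢inner refl = false≢true (trans (sym outer-out) inner-in)

    levelSplit-inner : inner ≡ a ⊎ inner ≡ a′
    levelSplit-inner = collision-unique outer≢inner same-level

    levelSplit⇒apex : τ inner ≡ g → cube b S ≐ apex inner
    levelSplit⇒apex τi≡g j = cong (λ s → b j + χ s) (agrees (refine-view inner j))
      where
      agrees : RefineView inner j → S j ≡ does (refine inner j ≤? g)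
      agrees (lower τj<g eq) = trans (below j (subst (τ j ℕ.<_) (sym τi≡g) τj<g))
        (sym (dec-true (refine inner j ≤? g) (subst (ℕ._≤ g) (sym eq) (ℕP.<⇒≤ τj<g))))
      agrees (split _ refl eq) =
        trans inner-in (sym (dec-true (refine inner j ≤? g) (ℕP.≤-reflexive eq)))
      agrees (upper g≤τj j≢inner eq) = trans Sj≡false (sym (dec-false (refine inner j ≤? g)
        (λ r≤g → ℕP.1+n≰n (ℕP.≤-trans (subst (ℕ._≤ g) eq r≤g) g≤τj))))
        where
        Sj≡false : S j ≡ false
        Sj≡false with ℕP.m≤n⇒m<n∨m≡n g≤τj
        ... | inj₁ g<τj = above j (subst (ℕ._< τ j) (sym τi≡g) g<τj)
        ... | inj₂ g≡τj = subst (λ j′ → S j′ ≡ false)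
          (sym (fiber-pair outer≢inner same-level j≢inner (trans (sym g≡τj) (sym τi≡g)))) outer-out

  new-vertex≈apex : ∀ w → (∀ k → Adjacent (staircase b τ k) w) → (∀ k → ¬ w ≈ staircase b τ k) →
             w ≈ apex a ⊎ w ≈ apex a′
  new-vertex≈apex w adjacent new = conclude (levelSplit-inner sp)
    where
    top-cube : ∃[ S ] w ≈ cube (staircase b τ (fromℕ m)) S
    top-cube = Adjacent⇒≈cube {x = staircase b τ (fromℕ m)} {w} (adjacent (fromℕ m))
    S : Fin (suc (suc m)) → Bool
    S = proj₁ top-cube
    w≈W : w ≈ cube b S
    w≈W = begin
      w                                 ≈⟨ proj₂ top-cube ⟩
      cube (staircase b τ (fromℕ m)) S  ≈⟨ + 1 , (λ j → trans (cong (_+ χ (S j))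
                                             (staircase-top b τ bounded j)) (swap (b j) (χ (S j)))) ⟩
      cube b S                          ∎
      where
      open ≈-Reasoning
      swap : ∀ a s → a + + 1 + s ≡ a + s + + 1
      swap = solve-∀
    sp : LevelSplit τ S
    sp = levelSplit b τ bounded S
      (λ k → Adjacent-respʳ-≈ {x = staircase b τ k} {w} {cube b S} w≈W (adjacent k))
      (λ k W≈k → new k (≈-trans {x = w} {cube b S} {staircase b τ k} w≈W W≈k))
    w≈apex : ∀ {c} → LevelSplit.inner sp ≡ c → τ c ≡ g → w ≈ apex c
    w≈apex {c} refl τc≡g = ≈-trans {x = w} {cube b S} {apex c} w≈W (≐⇒≈ (levelSplit⇒apex sp τc≡g))
    conclude : LevelSplit.inner sp ≡ a ⊎ LevelSplit.inner sp ≡ a′ → w ≈ apex a ⊎ w ≈ apex a′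
    conclude (inj₁ inner≡a)  = inj₁ (w≈apex inner≡a τa≡g)
    conclude (inj₂ inner≡a′) = inj₂ (w≈apex inner≡a′ τa′≡g)

-- The staircase of σ is a parameter, rather than computed from σ, so that its construction is
-- never unfolded during conversion checking.
module BoundaryAt {m : ℕ} {β : (Fin (suc (suc m)) → Pt (suc (suc m))) → ℤ}
                  (chain : IsChain (suc (suc m)) (suc m) β)
                  (std : ∀ u → IsStdOrientation (suc m) u → β u ≡ + 1)
                  {v : Fin (suc m) → Pt (suc (suc m))} (σ : IsSimplex m v)
                  (st : Staircase m (proj₁ σ)) where

  open Simplex σ st using (base; level; bounded; onto; vertex≈; π)
  open CodimOne base level bounded onto

  π′ : Permutation′ (suc (suc m))
  π′ = insert zero G π

  module Coface {c c′} (c′≢c : c′ ≢ c) (τc≡g : level c ≡ g) (τc′≡g : level c′ ≡ g) where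

    onto′ : Onto (suc m) (refine c)
    onto′ = refine-onto c′≢c τc≡g τc′≡g

    X : Fin (suc (suc m)) → Pt (suc (suc m))
    X = staircase base (refine c)

    position : ∀ k → (apex c ∷ᶠ v) k ≈ X (π′ ⟨$⟩ʳ k)
    position zero    = ≈-refl
    position (suc l) = begin
      v l                              ≈⟨ vertex≈ l ⟩
      staircase base level (π ⟨$⟩ʳ l) ≈⟨ ≐⇒≈ (λ j → cong (λ s → base j + χ s)
                                           (sym (refine-punchIn c τc≡g (π ⟨$⟩ʳ l) j))) ⟩
      X (punchIn G (π ⟨$⟩ʳ l))        ≡⟨ cong X (insert-punchIn zero G π l) ⟨
      X (π′ ⟨$⟩ʳ suc l)               ∎
      where open ≈-Reasoning

    X-small : IsSmallChain (suc m) X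
    X-small = staircase-isSmallChain base (refine c) (refine-bounded c) onto′

    isSimplex : IsSimplex (suc m) (apex c ∷ᶠ v)
    isSimplex = X , π′ , X-small , position

    P : Permutation′ (suc (suc m))
    P = levelPermutation (refine c) (refine-bounded c) onto′

    toℕ-P : ∀ j → toℕ (P ⟨$⟩ʳ j) ≡ refine c j
    toℕ-P = toℕ-levelPermutation (refine c) (refine-bounded c) onto′

    oriented : Fin (suc (suc m)) → Pt (suc (suc m))
    oriented = X ∘ (P ⟨$⟩ʳ_)

    oriented-isSimplex : IsSimplex (suc m) oriented
    oriented-isSimplex = X , P , X-small , λ _ → ≈-refl

    β-oriented : β oriented ≡ + 1
    β-oriented = std oriented (staircase-isStdOrientation (refine c) (refine-bounded c) onto′ base)

    ρ : Permutation′ (suc (suc m))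
    ρ = π′ ∘ₚ flip P

    reorder : ∀ k → oriented (ρ ⟨$⟩ʳ k) ≈ (apex c ∷ᶠ v) k
    reorder k = begin
      oriented (ρ ⟨$⟩ʳ k)  ≡⟨ cong X (inverseʳ P) ⟩
      X (π′ ⟨$⟩ʳ k)        ≈⟨ position k ⟨
      (apex c ∷ᶠ v) k       ∎
      where open ≈-Reasoning

  module A  = Coface (a≢a′ ∘ sym) τa≡g τa′≡g
  module A′ = Coface a≢a′ τa′≡g τa≡g

  swap-reorder : ∀ k → A′.oriented (transpose a a′ ⟨$⟩ʳ (A.ρ ⟨$⟩ʳ k)) ≈ (apex a′ ∷ᶠ v) k
  swap-reorder k = begin
    A′.X (A′.P ⟨$⟩ʳ (transpose a a′ ⟨$⟩ʳ (A.ρ ⟨$⟩ʳ k))) ≡⟨ cong A′.X (P-swap (A.ρ ⟨$⟩ʳ k)) ⟩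
    A′.X (A.P ⟨$⟩ʳ (A.ρ ⟨$⟩ʳ k))                        ≡⟨ cong A′.X (inverseʳ A.P) ⟩
    A′.X (π′ ⟨$⟩ʳ k)                                     ≈⟨ A′.position k ⟨
    (apex a′ ∷ᶠ v) k                                      ∎
    where
    open ≈-Reasoning
    P-swap : ∀ x → A′.P ⟨$⟩ʳ (transpose a a′ ⟨$⟩ʳ x) ≡ A.P ⟨$⟩ʳ x
    P-swap x = FP.toℕ-injective
      (trans (A′.toℕ-P (transpose a a′ ⟨$⟩ʳ x)) (trans (refine-swap x) (sym (A.toℕ-P x))))

  opposite-orientations : β (apex a ∷ᶠ v) + β (apex a′ ∷ᶠ v) ≡ + 0
  opposite-orientations = begin
    β (apex a ∷ᶠ v) + β (apex a′ ∷ᶠ v)             ≡⟨ cong₂ _+_ β-apex β-apex′ ⟩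
    sign A.ρ * β A.oriented + sign A.ρ * β swapped  ≡⟨ cong₂ (λ x y → sign A.ρ * x + sign A.ρ * y)
                                                          A.β-oriented β-swapped ⟩
    sign A.ρ * + 1 + sign A.ρ * - + 1               ≡⟨ cancel (sign A.ρ) ⟩
    + 0                                             ∎
    where
    open ≡-Reasoning
    swapped : Fin (suc (suc m)) → Pt (suc (suc m))
    swapped = A′.oriented ∘ (transpose a a′ ⟨$⟩ʳ_)
    swapped-isSimplex : IsSimplex (suc m) swapped
    swapped-isSimplex = simplex-permute A′.oriented-isSimplex (transpose a a′)
    β-apex : β (apex a ∷ᶠ v) ≡ sign A.ρ * β A.oriented
    β-apex = trans (sym (proj₁ chain (A.oriented ∘ (A.ρ ⟨$⟩ʳ_)) (apex a ∷ᶠ v)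
                     (simplex-permute A.oriented-isSimplex A.ρ) A.reorder))
                   (chain-permute chain A.oriented A.oriented-isSimplex A.ρ)
    β-apex′ : β (apex a′ ∷ᶠ v) ≡ sign A.ρ * β swapped
    β-apex′ = trans (sym (proj₁ chain (swapped ∘ (A.ρ ⟨$⟩ʳ_)) (apex a′ ∷ᶠ v)
                      (simplex-permute swapped-isSimplex A.ρ) swap-reorder))
                    (chain-permute chain swapped swapped-isSimplex A.ρ)
    β-swapped : β swapped ≡ - + 1
    β-swapped = trans (proj₂ chain A′.oriented A′.oriented-isSimplex a a′ a≢a′) (cong -_ A′.β-oriented)
    cancel : ∀ s → s * + 1 + s * - + 1 ≡ + 0
    cancel = solve-∀

  coface≈apex : ∀ w → IsSimplex (suc m) (w ∷ᶠ v) → w ≈ apex a ⊎ w ≈ apex a′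
  coface≈apex w σw = new-vertex≈apex w adjacent new
    where
    module W = Simplex σw (simplex-staircase σw)
    vertex : ∀ k → staircase base level k ≈ v (π ⟨$⟩ˡ k)
    vertex k = begin
      staircase base level k                     ≡⟨ cong (staircase base level) (inverseʳ π) ⟨
      staircase base level (π ⟨$⟩ʳ (π ⟨$⟩ˡ k))  ≈⟨ vertex≈ (π ⟨$⟩ˡ k) ⟨
      v (π ⟨$⟩ˡ k)                               ∎
      where open ≈-Reasoning
    adjacent : ∀ k → Adjacent (staircase base level k) w
    adjacent k = Adjacent-respˡ-≈ {x = v (π ⟨$⟩ˡ k)} {staircase base level k} {w}
      (≈-sym {x = staircase base level k} {v (π ⟨$⟩ˡ k)} (vertex k)) (W.adjacent (suc (π ⟨$⟩ˡ k)) zero)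
    new : ∀ k → ¬ w ≈ staircase base level k
    new k w≈k = zero≢suc (W.distinct {zero} {suc (π ⟨$⟩ˡ k)}
                     (≈-trans {x = w} {staircase base level k} {v (π ⟨$⟩ˡ k)} w≈k (vertex k)))
      where zero≢suc : ∀ {n} {l : Fin n} → zero ≢ suc l
            zero≢suc ()

  cofaces : List (Pt (suc (suc m)))
  cofaces = apex a ∷ apex a′ ∷ []

  cofaces-enumerate : IsCofaceEnum m v cofaces
  cofaces-enumerate = member-simplex , complete , (apex-≉ ∷ []) ∷ [] ∷ []
    where
    member-simplex : ∀ {w} → w ∈ cofaces → IsSimplex (suc m) (w ∷ᶠ v)
    member-simplex (here refl)         = A.isSimplex
    member-simplex (there (here refl)) = A′.isSimplex
    complete : ∀ w → IsSimplex (suc m) (w ∷ᶠ v) → ∃[ w′ ] (w′ ∈ cofaces × w ≈ w′)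
    complete w σw = [ (λ w≈apex → apex a , here refl , w≈apex)
                    , (λ w≈apex′ → apex a′ , there (here refl) , w≈apex′) ] (coface≈apex w σw)

  boundary-vanishes : ∀ L → IsCofaceEnum m v L → boundaryCoeff β v L ≡ + 0
  boundary-vanishes L (member-simplex , complete , distinct) = cong -_ (trans
    (sum-over-two-classes (λ w → β (w ∷ᶠ v)) L apex-≉ distinct classes
       (complete (apex a) A.isSimplex) (complete (apex a′) A′.isSimplex))
    opposite-orientations)
    where
    same-coface : ∀ {w c} → w ∈ L → w ≈ c → β (w ∷ᶠ v) ≡ β (c ∷ᶠ v)
    same-coface {w} {c} w∈L w≈c =
      proj₁ chain (w ∷ᶠ v) (c ∷ᶠ v) (member-simplex w∈L) λ { zero → w≈c ; (suc l) → ≈-refl }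
    classes : ∀ {w} → w ∈ L → (w ≈ apex a × β (w ∷ᶠ v) ≡ β (apex a ∷ᶠ v))
                            ⊎ (w ≈ apex a′ × β (w ∷ᶠ v) ≡ β (apex a′ ∷ᶠ v))
    classes {w} w∈L = Sum.map (λ w≈apex → w≈apex , same-coface w∈L w≈apex)
                              (λ w≈apex′ → w≈apex′ , same-coface w∈L w≈apex′)
                              (coface≈apex w (member-simplex w∈L))

proposition3p3 : (n : ℕ) (β : (Fin (suc n) → Pt (suc n)) → ℤ) →
    IsChain (suc n) n β →
    (∀ u → IsStdOrientation n u → β u ≡ + 1) →
    IsCycle (suc n) n β
proposition3p3 zero    β chain std = tt
proposition3p3 (suc m) β chain std v σ = (cofaces , cofaces-enumerate) , boundary-vanishes
  where open BoundaryAt chain std σ (simplex-staircase σ)
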